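{- Let $i \ge 0$ be an integer and let $n$ be a non-negative integer with $n \le 2^i$. For each $\ell \ge 0$, let $b_0(n,i,\ell)$ be the number of $i$-bit BSD representations of $n$ that have exactly $\ell$ digits equal to $0$ (and thus have Hamming weight $i-\ell$). Then $$B_{2^i-n}(t)=\sum_{\ell \ge 0} b_0(n,i,\ell)\, t^\ell .$$
   Context: The Stern polynomials $B_n(t)\in\mathbb{Z}[t]$, $n\ge 0$, are defined by $B_0=0$, $B_1=1$, $B_{2n}=t\,B_n$, $B_{2n+1}=B_n+B_{n+1}$. An $i$-bit binary signed-digit (BSD) representation of an integer $n$ is a string of digits $(b_{i-1}\cdots b_0)$ with each $b_j\in\{1,0,-1\}$ such that $n=\sum_{j=0}^{i-1} b_j 2^j$. Its Hamming weight is the number of nonzero digits. -}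

module Defs where

open import Data.Nat as ℕ using (ℕ; zero; suc; _∸_; _^_)
open import Data.Integer as ℤ using (ℤ; +_; -[1+_])
open import Data.List using (List; []; _∷_; map; concatMap; filter; length)
open import Data.Vec using (Vec; []; _∷_)
open import Data.Product using (_×_; _,_)
open import Relation.Nullary.Decidable using (_×-dec_)

-- Polynomials in ℤ[t] as coefficient lists, lowest degree first.

Poly : Set
Poly = List ℤ

_⊕_ : Poly → Poly → Poly
[] ⊕ q = q
(a ∷ p) ⊕ [] = a ∷ p
(a ∷ p) ⊕ (b ∷ q) = (a ℤ.+ b) ∷ (p ⊕ q)

shiftT : Poly → Poly
shiftT p = ℤ.0ℤ ∷ p

coeff : Poly → ℕ → ℤ
coeff [] ℓ = ℤ.0ℤ
coeff (a ∷ p) zero = a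
coeff (a ∷ p) (suc ℓ) = coeff p ℓ

-- Stern polynomials: B 0 = 0, B 1 = 1, B (2n) = t B n, B (2n+1) = B n + B (n+1).
-- Computed with fuel (fuel ≥ n suffices since n/2 , n/2+1 < n for n ≥ 2).

sternAux : ℕ → ℕ → Poly
sternAux fuel zero = []
sternAux fuel (suc zero) = ℤ.1ℤ ∷ []
sternAux zero (suc (suc n)) = []
sternAux (suc fuel) (suc (suc n)) with n ℕ.% 2
... | zero  = shiftT (sternAux fuel (suc (n ℕ./ 2)))                         -- 2+n = 2(1 + n/2)
... | suc _ = sternAux fuel (suc (n ℕ./ 2)) ⊕ sternAux fuel (suc (suc (n ℕ./ 2)))  -- 2+n = 2(1+n/2)+1

stern : ℕ → Poly
stern n = sternAux n n

data Digit : Set where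
  d₋₁ d₀ d₁ : Digit

digitVal : Digit → ℤ
digitVal d₋₁ = -[1+ 0 ]
digitVal d₀  = + 0
digitVal d₁  = + 1

-- A digit string (b_{i-1} ... b_0) stored least-significant first:
-- b₀ ∷ b₁ ∷ ... ; value = Σ b_j 2^j.
bsdValue : ∀ {i} → Vec Digit i → ℤ
bsdValue [] = + 0
bsdValue (b ∷ bs) = digitVal b ℤ.+ (+ 2) ℤ.* bsdValue bs

isZero : Digit → ℕ
isZero d₀ = 1
isZero d₋₁ = 0
isZero d₁ = 0

zeroCount : ∀ {i} → Vec Digit i → ℕ
zeroCount [] = 0
zeroCount (b ∷ bs) = isZero b ℕ.+ zeroCount bs

allStrings : (i : ℕ) → List (Vec Digit i)
allStrings zero = [] ∷ []
allStrings (suc i) = concatMap (λ bs → (d₋₁ ∷ bs) ∷ (d₀ ∷ bs) ∷ (d₁ ∷ bs) ∷ []) (allStrings i)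

b0 : ℕ → ℕ → ℕ → ℕ
b0 n i ℓ = length (filter (λ bs → (bsdValue bs ℤ.≟ + n) ×-dec (zeroCount bs ℕ.≟ ℓ)) (allStrings i))

{-# OPTIONS --safe #-}

-- Induction on i, simultaneously for all j + n = 2^i, shows that B_j has the coefficients b₀(n,i,ℓ).
-- If j + n = 2^(i+1) then j and n have the same parity.  Split off the last digit d of an
-- (i+1)-digit representation of n: for n = 2b necessarily d = 0 and the other digits represent b
-- with one zero fewer, matching B_{2a} = t B_a (a + b = 2^i); for n = 2b+1 either d = 1 and the rest
-- represents b, or d = −1 and the rest represents b+1, matching B_{2a+1} = B_a + B_{a+1}
-- (a + (b+1) = (a+1) + b = 2^i).

module Submission where

open import Defs
open import Data.Nat using (ℕ; _≤_; _∸_; _^_)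
open import Data.Integer using (+_)
open import Relation.Binary.PropositionalEquality using (_≡_)

open import Data.Bool using (true; false; if_then_else_)
open import Data.Nat as ℕ using (zero; suc; s≤s)
import Data.Nat.Properties as ℕ
open import Data.Nat.DivMod using (_%_; _/_; m*n%n≡0; m*n/n≡m; [m+kn]%n≡m%n; m/n≡1+[m∸n]/n; m/n≤m; m/n<m)
open import Data.Nat.Tactic.RingSolver as ℕ-Solver using ()
open import Data.Integer as ℤ using (ℤ; -1ℤ; ∣_∣)
import Data.Integer.Properties as ℤ
open import Data.Integer.Tactic.RingSolver using (solve-∀)
open import Algebra.Properties.AbelianGroup ℤ.+-0-abelianGroup using (∙-cancelˡ)
open import Data.List using (List; []; _∷_; filter; length; concatMap)
open import Data.List.Properties using (filter-≐; filter-none)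
open import Data.List.Relation.Unary.All using (universal)
open import Data.Vec using (Vec; []; _∷_)
open import Data.Empty using (⊥-elim)
open import Data.Product using (_×_; _,_)
open import Data.Product.Function.NonDependent.Propositional using (_×-⇔_)
open import Function using (_∘_; _⇔_; mk⇔; Equivalence)
open import Function.Construct.Identity using (⇔-id)
open import Relation.Nullary using (¬_; does; contradiction)
open import Relation.Nullary.Decidable using (_×-dec_)
open import Relation.Unary using (Pred; Decidable)
open import Relation.Binary.PropositionalEquality using (_≢_; refl; sym; trans; cong; cong₂; subst; module ≡-Reasoning)

coeff-⊕ : ∀ p q ℓ → coeff (p ⊕ q) ℓ ≡ coeff p ℓ ℤ.+ coeff q ℓ
coeff-⊕ []      q       ℓ       = sym (ℤ.+-identityˡ _)
coeff-⊕ (a ∷ p) []      zero    = sym (ℤ.+-identityʳ _)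
coeff-⊕ (a ∷ p) []      (suc ℓ) = sym (ℤ.+-identityʳ _)
coeff-⊕ (a ∷ p) (b ∷ q) zero    = refl
coeff-⊕ (a ∷ p) (b ∷ q) (suc ℓ) = coeff-⊕ p q ℓ

odd⇒n/2<n : ∀ {n r} → n % 2 ≡ suc r → n / 2 ℕ.< n
odd⇒n/2<n {suc n} _ = m/n<m (suc n) 2 ℕ.≤-refl

n<h⇒n/2<h : ∀ {n h} → n ℕ.< h → n / 2 ℕ.< h
n<h⇒n/2<h {n} = ℕ.≤-<-trans (m/n≤m n 2)

sternAux-fuel-irrelevant : ∀ {f g} n → n ≤ f → n ≤ g → sternAux f n ≡ sternAux g n
sternAux-fuel-irrelevant zero       _ _ = refl
sternAux-fuel-irrelevant (suc zero) _ _ = refl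
sternAux-fuel-irrelevant {suc f} {suc g} (suc (suc n)) (s≤s n<f) (s≤s n<g) with n % 2 in n%2
... | zero  = cong shiftT (sternAux-fuel-irrelevant (suc (n / 2)) (n<h⇒n/2<h n<f) (n<h⇒n/2<h n<g))
... | suc _ = cong₂ _⊕_
  (sternAux-fuel-irrelevant (suc (n / 2)) (n<h⇒n/2<h n<f) (n<h⇒n/2<h n<g))
  (sternAux-fuel-irrelevant (suc (suc (n / 2))) (ℕ.≤-<-trans (odd⇒n/2<n n%2) n<f) (ℕ.≤-<-trans (odd⇒n/2<n n%2) n<g))

[k*2]%2≡0 : ∀ k → k ℕ.* 2 % 2 ≡ 0
[k*2]%2≡0 k = m*n%n≡0 k 2

[k*2]/2≡k : ∀ k → k ℕ.* 2 / 2 ≡ k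
[k*2]/2≡k k = m*n/n≡m k 2

[1+k*2]%2≡1 : ∀ k → suc (k ℕ.* 2) % 2 ≡ 1
[1+k*2]%2≡1 k = [m+kn]%n≡m%n 1 k 2

[1+k*2]/2≡k : ∀ k → suc (k ℕ.* 2) / 2 ≡ k
[1+k*2]/2≡k zero    = refl
[1+k*2]/2≡k (suc k) = trans (m/n≡1+[m∸n]/n {suc (suc k ℕ.* 2)} (s≤s (s≤s ℕ.z≤n))) (cong suc ([1+k*2]/2≡k k))

stern-double : ∀ k → stern (suc k ℕ.* 2) ≡ shiftT (stern (suc k))
stern-double k rewrite [k*2]%2≡0 k | [k*2]/2≡k k =
  cong shiftT (sternAux-fuel-irrelevant (suc k) (s≤s (ℕ.m≤m*n k 2)) ℕ.≤-refl)

stern-odd : ∀ k → stern (suc (k ℕ.* 2)) ≡ stern k ⊕ stern (suc k)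
stern-odd zero    = refl
stern-odd (suc k) rewrite [1+k*2]%2≡1 k | [1+k*2]/2≡k k =
  cong₂ _⊕_ (sternAux-fuel-irrelevant (suc k)       (ℕ.m≤n⇒m≤1+n 1+k≤1+k*2) ℕ.≤-refl)
            (sternAux-fuel-irrelevant (suc (suc k)) (s≤s 1+k≤1+k*2)          ℕ.≤-refl)
  where
  1+k≤1+k*2 : suc k ≤ suc (k ℕ.* 2)
  1+k≤1+k*2 = s≤s (ℕ.m≤m*n k 2)

-- Only coefficientwise: stern 0 is [] whereas shiftT (stern 0) is 0 ∷ [].
coeff-stern-double : ∀ k ℓ → coeff (stern (k ℕ.* 2)) ℓ ≡ coeff (shiftT (stern k)) ℓ
coeff-stern-double zero    zero    = refl
coeff-stern-double zero    (suc ℓ) = refl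
coeff-stern-double (suc k) ℓ       = cong (λ p → coeff p ℓ) (stern-double k)

coeff-stern-odd : ∀ k ℓ → coeff (stern (suc (k ℕ.* 2))) ℓ ≡ coeff (stern k) ℓ ℤ.+ coeff (stern (suc k)) ℓ
coeff-stern-odd k ℓ = trans (cong (λ p → coeff p ℓ) (stern-odd k)) (coeff-⊕ (stern k) (stern (suc k)) ℓ)

module _ {a p} {A : Set a} {P : Pred A p} (P? : Decidable P) where

  count : List A → ℕ
  count xs = length (filter P? xs)

  indicator : A → ℕ
  indicator x = if does (P? x) then 1 else 0

  count-∷ : ∀ x xs → count (x ∷ xs) ≡ indicator x ℕ.+ count xs
  count-∷ x xs with does (P? x)
  ... | true  = refl
  ... | false = refl

  count-none : (∀ x → ¬ P x) → ∀ xs → count xs ≡ 0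
  count-none ¬P xs = cong length (filter-none P? (universal ¬P xs))

count-cong : ∀ {a p q} {A : Set a} {P : Pred A p} {Q : Pred A q} (P? : Decidable P) (Q? : Decidable Q) →
             (∀ x → P x ⇔ Q x) → ∀ xs → count P? xs ≡ count Q? xs
count-cong P? Q? P⇔Q xs =
  cong length (filter-≐ P? Q? ((λ {x} → Equivalence.to (P⇔Q x)) , (λ {x} → Equivalence.from (P⇔Q x))) xs)

count-concatMap₃ : ∀ {a b p} {A : Set a} {B : Set b} {P : Pred B p} (P? : Decidable P) (f g h : A → B) xs →
  count P? (concatMap (λ x → f x ∷ g x ∷ h x ∷ []) xs)
    ≡ count (P? ∘ f) xs ℕ.+ count (P? ∘ g) xs ℕ.+ count (P? ∘ h) xs
count-concatMap₃ P? f g h []       = refl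
count-concatMap₃ {A = A} {B} P? f g h (x ∷ xs) = begin
  count P? (f x ∷ g x ∷ h x ∷ rest)
    ≡⟨ count-∷ P? (f x) _ ⟩
  χ f ℕ.+ count P? (g x ∷ h x ∷ rest)
    ≡⟨ cong (χ f ℕ.+_) (count-∷ P? (g x) _) ⟩
  χ f ℕ.+ (χ g ℕ.+ count P? (h x ∷ rest))
    ≡⟨ cong (λ c → χ f ℕ.+ (χ g ℕ.+ c)) (count-∷ P? (h x) _) ⟩
  χ f ℕ.+ (χ g ℕ.+ (χ h ℕ.+ count P? rest))
    ≡⟨ cong (λ c → χ f ℕ.+ (χ g ℕ.+ (χ h ℕ.+ c))) (count-concatMap₃ P? f g h xs) ⟩
  χ f ℕ.+ (χ g ℕ.+ (χ h ℕ.+ (# f ℕ.+ # g ℕ.+ # h)))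
    ≡⟨ interchange (χ f) (χ g) (χ h) (# f) (# g) (# h) ⟩
  (χ f ℕ.+ # f) ℕ.+ (χ g ℕ.+ # g) ℕ.+ (χ h ℕ.+ # h)
    ≡⟨ sym (cong₂ ℕ._+_ (cong₂ ℕ._+_ (count-∷ (P? ∘ f) x xs) (count-∷ (P? ∘ g) x xs)) (count-∷ (P? ∘ h) x xs)) ⟩
  count (P? ∘ f) (x ∷ xs) ℕ.+ count (P? ∘ g) (x ∷ xs) ℕ.+ count (P? ∘ h) (x ∷ xs)
    ∎
  where
  open ≡-Reasoning
  rest : List B
  rest = concatMap (λ x → f x ∷ g x ∷ h x ∷ []) xs
  χ # : (A → B) → ℕ
  χ k = indicator P? (k x)
  # k = count (P? ∘ k) xs
  interchange : ∀ a b c d e f → a ℕ.+ (b ℕ.+ (c ℕ.+ (d ℕ.+ e ℕ.+ f))) ≡ (a ℕ.+ d) ℕ.+ (b ℕ.+ e) ℕ.+ (c ℕ.+ f)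
  interchange = ℕ-Solver.solve-∀

1+2v≢2w : ∀ v w → + 1 ℤ.+ + 2 ℤ.* v ≢ + 2 ℤ.* w
1+2v≢2w v w eq = contradiction (ℕ.m*n≡1⇒m≡1 2 ∣ w ℤ.- v ∣ (sym (trans (cong ∣_∣ 1≡2[w-v]) (ℤ.abs-* (+ 2) (w ℤ.- v))))) λ ()
  where
  open ≡-Reasoning
  isolate : ∀ v → + 1 ≡ (+ 1 ℤ.+ + 2 ℤ.* v) ℤ.- + 2 ℤ.* v
  isolate = solve-∀
  factor : ∀ v w → + 2 ℤ.* w ℤ.- + 2 ℤ.* v ≡ + 2 ℤ.* (w ℤ.- v)
  factor = solve-∀
  1≡2[w-v] : + 1 ≡ + 2 ℤ.* (w ℤ.- v)
  1≡2[w-v] = begin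
    + 1                                  ≡⟨ isolate v ⟩
    (+ 1 ℤ.+ + 2 ℤ.* v) ℤ.- + 2 ℤ.* v    ≡⟨ cong (ℤ._- + 2 ℤ.* v) eq ⟩
    + 2 ℤ.* w ℤ.- + 2 ℤ.* v              ≡⟨ factor v w ⟩
    + 2 ℤ.* (w ℤ.- v)                    ∎

-1+2v≢2w : ∀ v w → -1ℤ ℤ.+ + 2 ℤ.* v ≢ + 2 ℤ.* w
-1+2v≢2w v w eq = 1+2v≢2w (v ℤ.- + 1) w (trans (shift v) eq)
  where
  shift : ∀ v → + 1 ℤ.+ + 2 ℤ.* (v ℤ.- + 1) ≡ -1ℤ ℤ.+ + 2 ℤ.* v
  shift = solve-∀

0+2v≢1+2w : ∀ v w → + 0 ℤ.+ + 2 ℤ.* v ≢ + 1 ℤ.+ + 2 ℤ.* w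
0+2v≢1+2w v w eq = 1+2v≢2w w v (sym (trans (sym (ℤ.+-identityˡ _)) eq))

c+2v≡c+2w⇔v≡w : ∀ c v w → c ℤ.+ + 2 ℤ.* v ≡ c ℤ.+ + 2 ℤ.* w ⇔ v ≡ w
c+2v≡c+2w⇔v≡w c v w = mk⇔ (ℤ.*-cancelˡ-≡ (+ 2) v w ∘ ∙-cancelˡ c _ _) (cong (λ u → c ℤ.+ + 2 ℤ.* u))

0+2v≡2w⇔v≡w : ∀ v w → + 0 ℤ.+ + 2 ℤ.* v ≡ + 2 ℤ.* w ⇔ v ≡ w
0+2v≡2w⇔v≡w v w =
  subst (λ m → + 0 ℤ.+ + 2 ℤ.* v ≡ m ⇔ v ≡ w) (ℤ.+-identityˡ (+ 2 ℤ.* w)) (c+2v≡c+2w⇔v≡w (+ 0) v w)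

-1+2v≡1+2w⇔v≡w+1 : ∀ v w → -1ℤ ℤ.+ + 2 ℤ.* v ≡ + 1 ℤ.+ + 2 ℤ.* w ⇔ v ≡ w ℤ.+ + 1
-1+2v≡1+2w⇔v≡w+1 v w =
  subst (λ m → -1ℤ ℤ.+ + 2 ℤ.* v ≡ m ⇔ v ≡ w ℤ.+ + 1) (shift w) (c+2v≡c+2w⇔v≡w -1ℤ v (w ℤ.+ + 1))
  where
  shift : ∀ w → -1ℤ ℤ.+ + 2 ℤ.* (w ℤ.+ + 1) ≡ + 1 ℤ.+ + 2 ℤ.* w
  shift = solve-∀

Represents : ∀ {i} → ℤ → ℕ → Vec Digit i → Set
Represents m ℓ bs = bsdValue bs ≡ m × zeroCount bs ≡ ℓ

represents? : ∀ {i} m ℓ → Decidable (Represents {i} m ℓ)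
represents? m ℓ bs = (bsdValue bs ℤ.≟ m) ×-dec (zeroCount bs ℕ.≟ ℓ)

reps : ℕ → ℤ → ℕ → ℕ
reps i m ℓ = count (represents? m ℓ) (allStrings i)

repsEndingIn : Digit → ℕ → ℤ → ℕ → ℕ
repsEndingIn d i m ℓ = count (represents? m ℓ ∘ (d ∷_)) (allStrings i)

reps-suc : ∀ i m ℓ → reps (suc i) m ℓ ≡ repsEndingIn d₋₁ i m ℓ ℕ.+ repsEndingIn d₀ i m ℓ ℕ.+ repsEndingIn d₁ i m ℓ
reps-suc i m ℓ = count-concatMap₃ (represents? m ℓ) (d₋₁ ∷_) (d₀ ∷_) (d₁ ∷_) (allStrings i)

suc≡suc⇔ : ∀ {m n} → suc m ≡ suc n ⇔ m ≡ n
suc≡suc⇔ = mk⇔ ℕ.suc-injective (cong suc)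

repsEndingIn-d₋₁-even : ∀ i k ℓ → repsEndingIn d₋₁ i (+ 2 ℤ.* k) ℓ ≡ 0
repsEndingIn-d₋₁-even i k ℓ = count-none _ (λ x (eq , _) → -1+2v≢2w (bsdValue x) k eq) (allStrings i)

repsEndingIn-d₀-even-zero : ∀ i k → repsEndingIn d₀ i (+ 2 ℤ.* k) 0 ≡ 0
repsEndingIn-d₀-even-zero i k = count-none _ (λ x ()) (allStrings i)

repsEndingIn-d₀-even-suc : ∀ i k ℓ → repsEndingIn d₀ i (+ 2 ℤ.* k) (suc ℓ) ≡ reps i k ℓ
repsEndingIn-d₀-even-suc i k ℓ =
  count-cong _ (represents? k ℓ) (λ x → 0+2v≡2w⇔v≡w (bsdValue x) k ×-⇔ suc≡suc⇔) (allStrings i)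

repsEndingIn-d₁-even : ∀ i k ℓ → repsEndingIn d₁ i (+ 2 ℤ.* k) ℓ ≡ 0
repsEndingIn-d₁-even i k ℓ = count-none _ (λ x (eq , _) → 1+2v≢2w (bsdValue x) k eq) (allStrings i)

repsEndingIn-d₋₁-odd : ∀ i k ℓ → repsEndingIn d₋₁ i (+ 1 ℤ.+ + 2 ℤ.* k) ℓ ≡ reps i (k ℤ.+ + 1) ℓ
repsEndingIn-d₋₁-odd i k ℓ =
  count-cong _ (represents? (k ℤ.+ + 1) ℓ) (λ x → -1+2v≡1+2w⇔v≡w+1 (bsdValue x) k ×-⇔ ⇔-id _) (allStrings i)

repsEndingIn-d₀-odd : ∀ i k ℓ → repsEndingIn d₀ i (+ 1 ℤ.+ + 2 ℤ.* k) ℓ ≡ 0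
repsEndingIn-d₀-odd i k ℓ = count-none _ (λ x (eq , _) → 0+2v≢1+2w (bsdValue x) k eq) (allStrings i)

repsEndingIn-d₁-odd : ∀ i k ℓ → repsEndingIn d₁ i (+ 1 ℤ.+ + 2 ℤ.* k) ℓ ≡ reps i k ℓ
repsEndingIn-d₁-odd i k ℓ =
  count-cong _ (represents? k ℓ) (λ x → c+2v≡c+2w⇔v≡w (+ 1) (bsdValue x) k ×-⇔ ⇔-id _) (allStrings i)

reps-even-zero : ∀ i k → reps (suc i) (+ 2 ℤ.* k) 0 ≡ 0
reps-even-zero i k = trans (reps-suc i _ 0)
  (cong₂ ℕ._+_ (cong₂ ℕ._+_ (repsEndingIn-d₋₁-even i k 0) (repsEndingIn-d₀-even-zero i k)) (repsEndingIn-d₁-even i k 0))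

reps-even-suc : ∀ i k ℓ → reps (suc i) (+ 2 ℤ.* k) (suc ℓ) ≡ reps i k ℓ
reps-even-suc i k ℓ = begin
  reps (suc i) (+ 2 ℤ.* k) (suc ℓ)
    ≡⟨ reps-suc i _ _ ⟩
  repsEndingIn d₋₁ i _ (suc ℓ) ℕ.+ repsEndingIn d₀ i _ (suc ℓ) ℕ.+ repsEndingIn d₁ i _ (suc ℓ)
    ≡⟨ cong₂ ℕ._+_ (cong₂ ℕ._+_ (repsEndingIn-d₋₁-even i k _) (repsEndingIn-d₀-even-suc i k ℓ)) (repsEndingIn-d₁-even i k _) ⟩
  reps i k ℓ ℕ.+ 0
    ≡⟨ ℕ.+-identityʳ _ ⟩
  reps i k ℓ
    ∎
  where open ≡-Reasoning

reps-odd : ∀ i k ℓ → reps (suc i) (+ 1 ℤ.+ + 2 ℤ.* k) ℓ ≡ reps i (k ℤ.+ + 1) ℓ ℕ.+ reps i k ℓ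
reps-odd i k ℓ = begin
  reps (suc i) (+ 1 ℤ.+ + 2 ℤ.* k) ℓ
    ≡⟨ reps-suc i _ _ ⟩
  repsEndingIn d₋₁ i _ ℓ ℕ.+ repsEndingIn d₀ i _ ℓ ℕ.+ repsEndingIn d₁ i _ ℓ
    ≡⟨ cong₂ ℕ._+_ (cong₂ ℕ._+_ (repsEndingIn-d₋₁-odd i k ℓ) (repsEndingIn-d₀-odd i k ℓ)) (repsEndingIn-d₁-odd i k ℓ) ⟩
  reps i (k ℤ.+ + 1) ℓ ℕ.+ 0 ℕ.+ reps i k ℓ
    ≡⟨ cong (ℕ._+ reps i k ℓ) (ℕ.+-identityʳ _) ⟩
  reps i (k ℤ.+ + 1) ℓ ℕ.+ reps i k ℓ
    ∎
  where open ≡-Reasoning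

_HasCoeffs_ : Poly → (ℕ → ℕ) → Set
p HasCoeffs c = ∀ ℓ → coeff p ℓ ≡ + c ℓ

+[k*2]≡2*k : ∀ k → + (k ℕ.* 2) ≡ + 2 ℤ.* + k
+[k*2]≡2*k k = trans (cong +_ (ℕ.*-comm k 2)) (ℤ.pos-* 2 k)

double-step : ∀ i a b → stern a HasCoeffs reps i (+ b) → stern (a ℕ.* 2) HasCoeffs reps (suc i) (+ (b ℕ.* 2))
double-step i a b ih zero rewrite +[k*2]≡2*k b =
  trans (coeff-stern-double a 0) (cong +_ (sym (reps-even-zero i (+ b))))
double-step i a b ih (suc ℓ) rewrite +[k*2]≡2*k b =
  trans (coeff-stern-double a (suc ℓ)) (trans (ih ℓ) (cong +_ (sym (reps-even-suc i (+ b) ℓ))))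

odd-step : ∀ i a b → stern a HasCoeffs reps i (+ suc b) → stern (suc a) HasCoeffs reps i (+ b) →
           stern (suc (a ℕ.* 2)) HasCoeffs reps (suc i) (+ suc (b ℕ.* 2))
odd-step i a b ih₁ ih₂ ℓ = begin
  coeff (stern (suc (a ℕ.* 2))) ℓ                         ≡⟨ coeff-stern-odd a ℓ ⟩
  coeff (stern a) ℓ ℤ.+ coeff (stern (suc a)) ℓ           ≡⟨ cong₂ ℤ._+_ (ih₁ ℓ) (ih₂ ℓ) ⟩
  + reps i (+ suc b) ℓ ℤ.+ + reps i (+ b) ℓ               ≡⟨ cong (λ m → + reps i m ℓ ℤ.+ + reps i (+ b) ℓ) (cong +_ (ℕ.+-comm 1 b)) ⟩
  + (reps i (+ b ℤ.+ + 1) ℓ ℕ.+ reps i (+ b) ℓ)           ≡⟨ cong +_ (sym (reps-odd i (+ b) ℓ)) ⟩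
  + reps (suc i) (+ 1 ℤ.+ + 2 ℤ.* + b) ℓ                  ≡⟨ cong (λ m → + reps (suc i) (+ 1 ℤ.+ m) ℓ) (sym (+[k*2]≡2*k b)) ⟩
  + reps (suc i) (+ suc (b ℕ.* 2)) ℓ                      ∎
  where open ≡-Reasoning

data Parity : ℕ → Set where
  even : ∀ k → Parity (k ℕ.* 2)
  odd  : ∀ k → Parity (suc (k ℕ.* 2))

parity : ∀ n → Parity n
parity zero = even zero
parity (suc n) with parity n
... | even k = odd k
... | odd k  = even (suc k)

even≢odd : ∀ k m → k ℕ.* 2 ≢ suc (m ℕ.* 2)
even≢odd k m eq = contradiction (trans (sym ([k*2]%2≡0 k)) (trans (cong (_% 2) eq) ([1+k*2]%2≡1 m))) λ ()

stern-coeffs : ∀ i j n → j ℕ.+ n ≡ 2 ^ i → stern j HasCoeffs reps i (+ n)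
stern-coeffs zero zero          (suc zero)    _  ℓ       = refl
stern-coeffs zero (suc zero)    zero          _  zero    = refl
stern-coeffs zero (suc zero)    zero          _  (suc ℓ) = refl
stern-coeffs zero zero          zero          ()
stern-coeffs zero zero          (suc (suc n)) ()
stern-coeffs zero (suc zero)    (suc n)       ()
stern-coeffs zero (suc (suc j)) n             ()
stern-coeffs (suc i) j n j+n≡2^[1+i] = step (parity j) (parity n) (trans j+n≡2^[1+i] (ℕ.*-comm 2 (2 ^ i)))
  where
  halve : ∀ {x} → x ℕ.* 2 ≡ 2 ^ i ℕ.* 2 → x ≡ 2 ^ i
  halve {x} = ℕ.*-cancelʳ-≡ x (2 ^ i) 2
  odd+odd : ∀ a b → suc (a ℕ.* 2) ℕ.+ suc (b ℕ.* 2) ≡ (a ℕ.+ suc b) ℕ.* 2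
  odd+odd = ℕ-Solver.solve-∀
  even+odd : ∀ a b → a ℕ.* 2 ℕ.+ suc (b ℕ.* 2) ≡ suc ((a ℕ.+ b) ℕ.* 2)
  even+odd = ℕ-Solver.solve-∀
  odd+even : ∀ a b → suc (a ℕ.* 2) ℕ.+ b ℕ.* 2 ≡ suc ((a ℕ.+ b) ℕ.* 2)
  odd+even = ℕ-Solver.solve-∀
  step : ∀ {j n} → Parity j → Parity n → j ℕ.+ n ≡ 2 ^ i ℕ.* 2 → stern j HasCoeffs reps (suc i) (+ n)
  step (even a) (even b) eq = double-step i a b (stern-coeffs i a b (halve (trans (ℕ.*-distribʳ-+ 2 a b) eq)))
  step (odd a)  (odd b)  eq = odd-step i a b (stern-coeffs i a (suc b) a+[1+b]≡2^i)
                                             (stern-coeffs i (suc a) b (trans (sym (ℕ.+-suc a b)) a+[1+b]≡2^i))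
    where
    a+[1+b]≡2^i : a ℕ.+ suc b ≡ 2 ^ i
    a+[1+b]≡2^i = halve (trans (sym (odd+odd a b)) eq)
  step (even a) (odd b)  eq = ⊥-elim (even≢odd (2 ^ i) (a ℕ.+ b) (trans (sym eq) (even+odd a b)))
  step (odd a)  (even b) eq = ⊥-elim (even≢odd (2 ^ i) (a ℕ.+ b) (trans (sym eq) (odd+even a b)))

mainTheorem1 : (i n : ℕ) → n ≤ 2 ^ i →
    ∀ (ℓ : ℕ) → coeff (stern (2 ^ i ∸ n)) ℓ ≡ + b0 n i ℓ
mainTheorem1 i n n≤2^i = stern-coeffs i (2 ^ i ∸ n) n (ℕ.m∸n+n≡m n≤2^i)
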